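{- Let $p$ be a prime, $\beta$ a positive integer, $r$ an integer, and put $l=p^\beta$. Consider integer pairs $(r_1',r_p')$ with $r_1'+r_p'=r$ satisfying $(r_1'(l-1)+r_p'(pl-1))\equiv0\pmod{24}$, $(p\,r_1'(l-1)+r_p'(pl-1))\equiv0\pmod{24}$, and $l^{|r|}\prod_{n\in\{1,p\},\ 2\nmid r_n'}n$ is a perfect square. Such a pair exists if and only if $24\mid r(p^2-1)$. In that case the set of all such pairs is exactly: if $\beta$ is odd, $r_1'=-\frac{24}{\gcd(12,p-1)}y$, $r_p'=r-r_1'$ with $y\in\mathbb Z$; if $\beta$ is even, $r_1'=r-\frac{24}{\gcd(12,p-1)}y$, $r_p'=r-r_1'$ with $y\in\mathbb Z$. -}

module Defs where

open import Data.Nat as ℕ using (ℕ; _∸_; _/_; ≢-nonZero)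
open import Data.Nat.GCD using (gcd; gcd[m,n]≢0)
open import Data.Nat.Divisibility using (_∣?_)
open import Data.Integer as ℤ using (ℤ; ∣_∣)
open import Data.Bool using (if_then_else_)
open import Data.Sum using (inj₁)
open import Data.Product using (∃; _×_)
open import Data.Integer.Divisibility renaming (_∣_ to _∣ℤ_)
open import Relation.Nullary using (does)
open import Relation.Binary.PropositionalEquality using (_≡_)

IsSquare : ℕ → Set
IsSquare m = ∃ λ k → k ℕ.* k ≡ m

-- contribution of n to the product  ∏_{n ∈ {1,p}, 2 ∤ r_n'} n :
-- n if r_n' is odd, 1 otherwise
oddFactor : ℤ → ℕ → ℕ
oddFactor r n = if does (2 ∣? ∣ r ∣) then 1 else n

coeff : ℕ → ℕ
coeff p = _/_ 24 (gcd 12 (p ∸ 1)) {{≢-nonZero (gcd[m,n]≢0 12 (p ∸ 1) (inj₁ λ ()))}}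

Admissible : ℕ → ℕ → ℤ → ℤ → ℤ → Set
Admissible p β r r₁ rₚ =
  let l = p ℕ.^ β in
  (r₁ ℤ.+ rₚ ≡ r) × 
  ((ℤ.+ 24) ∣ℤ (r₁ ℤ.* (ℤ.+ l ℤ.- ℤ.+ 1) ℤ.+ rₚ ℤ.* (ℤ.+ (p ℕ.* l) ℤ.- ℤ.+ 1))) ×
  ((ℤ.+ 24) ∣ℤ (ℤ.+ p ℤ.* r₁ ℤ.* (ℤ.+ l ℤ.- ℤ.+ 1) ℤ.+ rₚ ℤ.* (ℤ.+ (p ℕ.* l) ℤ.- ℤ.+ 1))) ×
  IsSquare (l ℕ.^ ∣ r ∣ ℕ.* (oddFactor r₁ 1 ℕ.* oddFactor rₚ p))

-- Writing l = p^β, the number in the perfect-square condition is p^(β|r| + [rₚ odd]), so for prime p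
-- that condition says 2 ∣ βr + rₚ. Every condition is then invariant under changing p, l, r, r₁, rₚ
-- modulo 24 and β modulo 2, and so is the coefficient 24 / gcd(12, p - 1). A prime is 2, 3 or a unit
-- modulo 24, and p^β modulo 24 takes at most two values for each parity of β, so the theorem reduces to
-- a finite table over the residues of p, p^β, β, r and r₁, which is verified by evaluation.

module Submission where

open import Defs
open import Data.Nat as ℕ using (ℕ; zero; suc; _<_; _^_; _%_; _/_; _∸_; z<s; NonZero; ≢-nonZero)
open import Data.Nat.Properties
  using (allUpTo?; _≟_; _<?_; +-comm; *-comm; +-∸-comm; *-identityˡ; *-identityʳ; *-cancelʳ-≡; ^-distribˡ-+-*; ^-*-assoc)
open import Data.Nat.DivMod using (%-distribˡ-*; m%n%n≡m%n; m≡m%n+[m/n]*n; m%n<n; /-congʳ)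
open import Data.Nat.Divisibility
  using (_∣_; divides; _∣?_; _∣0; ∣1⇒≡1; ∣-refl; ∣-trans; ∣-antisym; ∣m∣n⇒∣m+n; ∣m+n∣m⇒∣n; ∣n⇒∣m*n; ∣n∣m%n⇒∣m;
         n∣m⇒m%n≡0; m/n∣m)
open import Data.Nat.GCD using (gcd; gcd[m,n]∣m; gcd[m,n]∣n; gcd-greatest; gcd[m,n]≢0)
open import Data.Nat.Primality using (Prime; euclidsLemma; prime⇒nonZero; prime⇒nonTrivial; prime⇒irreducible)
open import Data.Nat.Base using (NonTrivial; nonTrivial⇒≢1)
import Data.Nat.Tactic.RingSolver as ℕ-Solver
open import Data.Integer as ℤ using (ℤ; +_; -[1+_]; _+_; _-_; _*_; -_; _%ℕ_; _/ℕ_)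
import Data.Integer.Properties as ℤ
open import Data.Integer.DivMod using (a≡a%ℕn+[a/ℕn]*n; n%ℕd<d)
open import Data.Integer.Divisibility using () renaming (_∣_ to _∣ℤ_)
import Data.Integer.Divisibility.Signed as Signed
open import Data.Integer.Tactic.RingSolver using (solve-∀)
open import Data.Bool using (true; false)
open import Data.List using (List; []; _∷_)
open import Data.List.Membership.Propositional using (_∈_)
open import Data.List.Membership.DecPropositional _≟_ using (_∈?_)
open import Data.List.Relation.Unary.All using (All; all?; lookup)
open import Data.List.Relation.Unary.Any using (here; there)
open import Data.Product using (∃; ∃₂; _×_; _,_; proj₁; proj₂)
open import Data.Product.Function.NonDependent.Propositional using (_×-⇔_)
open import Data.Product.Function.Dependent.Propositional using (Σ-⇔)
open import Data.Sum using (_⊎_; inj₁; inj₂; [_,_]′)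
open import Data.Empty using (⊥-elim)
open import Function.Base using (id; _∘_)
open import Function.Bundles using (_⇔_; mk⇔; Equivalence)
open import Function.Construct.Identity using (⇔-id; ↠-id)
open import Function.Construct.Composition using (_⇔-∘_)
open import Function.Properties.Equivalence using (⇔-setoid)
open import Level using (0ℓ)
open import Relation.Nullary using (¬_; yes; no; does; contradiction)
open import Relation.Nullary.Decidable using (Dec; _×-dec_; _⊎-dec_; _→-dec_; map′; from-yes)
open import Relation.Binary.PropositionalEquality
  using (_≡_; refl; sym; trans; cong; cong₂; subst; module ≡-Reasoning)
import Relation.Binary.Reasoning.Setoid as SetoidReasoning

module ⇔-Reasoning = SetoidReasoning (⇔-setoid 0ℓ)

n+n≡n*2 : ∀ n → n ℕ.+ n ≡ n ℕ.* 2
n+n≡n*2 = ℕ-Solver.solve-∀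

-- Congruence modulo n on ℤ

-- A record rather than a synonym for divisibility, so that x and y can be inferred from the type.
infix 4 _≡_mod_

record _≡_mod_ (x y : ℤ) (n : ℕ) : Set where
  constructor mk≡mod
  field
    divides-difference : + n Signed.∣ x - y

module _ {n : ℕ} where

  private
    divides-along : ∀ {u v} → u ≡ v → + n Signed.∣ u → + n Signed.∣ v
    divides-along = subst (+ n Signed.∣_)

  ≡⇒≡mod : ∀ {x y} → x ≡ y → x ≡ y mod n
  ≡⇒≡mod {x} refl = mk≡mod (Signed.divides (+ 0) (ℤ.+-inverseʳ x))

  ≡mod-refl : ∀ {x} → x ≡ x mod n
  ≡mod-refl = ≡⇒≡mod refl

  ≡mod-sym : ∀ {x y} → x ≡ y mod n → y ≡ x mod n
  ≡mod-sym {x} {y} (mk≡mod n∣x-y) = mk≡mod (divides-along (negate x y) (Signed.∣m⇒∣-m n∣x-y))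
    where
    negate : ∀ x y → - (x - y) ≡ y - x
    negate = solve-∀

  ≡mod-trans : ∀ {x y z} → x ≡ y mod n → y ≡ z mod n → x ≡ z mod n
  ≡mod-trans {x} {y} {z} (mk≡mod n∣x-y) (mk≡mod n∣y-z) =
    mk≡mod (divides-along (telescope x y z) (Signed.∣m∣n⇒∣m+n n∣x-y n∣y-z))
    where
    telescope : ∀ x y z → (x - y) + (y - z) ≡ x - z
    telescope = solve-∀

  +-cong-≡mod : ∀ {x x′ y y′} → x ≡ x′ mod n → y ≡ y′ mod n → x + y ≡ x′ + y′ mod n
  +-cong-≡mod {x} {x′} {y} {y′} (mk≡mod n∣x-x′) (mk≡mod n∣y-y′) =
    mk≡mod (divides-along (regroup x x′ y y′) (Signed.∣m∣n⇒∣m+n n∣x-x′ n∣y-y′))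
    where
    regroup : ∀ x x′ y y′ → (x - x′) + (y - y′) ≡ (x + y) - (x′ + y′)
    regroup = solve-∀

  neg-cong-≡mod : ∀ {x x′} → x ≡ x′ mod n → - x ≡ - x′ mod n
  neg-cong-≡mod {x} {x′} (mk≡mod n∣x-x′) =
    mk≡mod (divides-along (regroup x x′) (Signed.∣m⇒∣-m n∣x-x′))
    where
    regroup : ∀ x x′ → - (x - x′) ≡ - x - - x′
    regroup = solve-∀

  minus-cong-≡mod : ∀ {x x′ y y′} → x ≡ x′ mod n → y ≡ y′ mod n → x - y ≡ x′ - y′ mod n
  minus-cong-≡mod x≡x′ y≡y′ = +-cong-≡mod x≡x′ (neg-cong-≡mod y≡y′)

  *-cong-≡mod : ∀ {x x′ y y′} → x ≡ x′ mod n → y ≡ y′ mod n → x * y ≡ x′ * y′ mod n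
  *-cong-≡mod {x} {x′} {y} {y′} (mk≡mod n∣x-x′) (mk≡mod n∣y-y′) =
    mk≡mod (divides-along (regroup x x′ y y′)
      (Signed.∣m∣n⇒∣m+n (Signed.∣n⇒∣m*n x n∣y-y′) (Signed.∣m⇒∣m*n y′ n∣x-x′)))
    where
    regroup : ∀ x x′ y y′ → x * (y - y′) + (x - x′) * y′ ≡ x * y - x′ * y′
    regroup = solve-∀

  ≡mod⇒∣ℤ⇔∣ℤ : ∀ {x y} → x ≡ y mod n → + n ∣ℤ x ⇔ + n ∣ℤ y
  ≡mod⇒∣ℤ⇔∣ℤ x≡y = mk⇔ (transport x≡y) (transport (≡mod-sym x≡y))
    where
    cancel : ∀ x y → x - (x - y) ≡ y
    cancel = solve-∀
    transport : ∀ {x y} → x ≡ y mod n → + n ∣ℤ x → + n ∣ℤ y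
    transport {x} {y} (mk≡mod n∣x-y) n∣x =
      Signed.∣⇒∣ᵤ (divides-along (cancel x y)
        (Signed.∣m∣n⇒∣m-n (Signed.∣ᵤ⇒∣ {+ n} {x} n∣x) n∣x-y))

≡mod-weaken : ∀ {d n x y} → d ∣ n → x ≡ y mod n → x ≡ y mod d
≡mod-weaken d∣n (mk≡mod n∣x-y) = mk≡mod (Signed.∣-trans (Signed.∣ᵤ⇒∣ d∣n) n∣x-y)

≡mod-%ℕ : ∀ x n .{{_ : NonZero n}} → x ≡ + (x %ℕ n) mod n
≡mod-%ℕ x n = mk≡mod (Signed.divides (x /ℕ n)
  (trans (cong (_- + (x %ℕ n)) (a≡a%ℕn+[a/ℕn]*n x n)) (cancel (+ (x %ℕ n)) (x /ℕ n * + n))))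
  where
  cancel : ∀ r k → (r + k) - r ≡ k
  cancel = solve-∀

∣∣≡mod2 : ∀ x → + ℤ.∣ x ∣ ≡ x mod 2
∣∣≡mod2 (+ n) = ≡⇒≡mod refl
∣∣≡mod2 -[1+ n ] =
  mk≡mod (Signed.divides (+ suc n) (trans (sym (ℤ.pos-+ (suc n) (suc n))) (cong +_ (n+n≡n*2 (suc n)))))

-- Perfect squares among prime powers

even⇒isSquare : ∀ p {m} → 2 ∣ m → IsSquare (p ^ m)
even⇒isSquare p (divides j refl) = p ^ j , trans (sym (^-distribˡ-+-* p j j)) (cong (p ^_) (n+n≡n*2 j))

module _ {p : ℕ} (p-prime : Prime p) where

  private instance
    p≢0 = prime⇒nonZero p-prime
    p≢1 = prime⇒nonTrivial p-prime

  ∣square⇒∣ : ∀ {k} → p ∣ k ℕ.* k → p ∣ k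
  ∣square⇒∣ {k} = [ id , id ]′ ∘ euclidsLemma k k p-prime

  square≡p^1+m⇒cofactor : ∀ {k m} → k ℕ.* k ≡ p ^ suc m → ∃ λ q → q ℕ.* q ℕ.* p ≡ p ^ m
  square≡p^1+m⇒cofactor {k} {m} k²≡p^1+m
    with divides q refl ← ∣square⇒∣ {k} (divides (p ^ m) (trans k²≡p^1+m (*-comm p (p ^ m)))) =
    q , *-cancelʳ-≡ (q ℕ.* q ℕ.* p) (p ^ m) p (trans (regroup q p) (trans k²≡p^1+m (*-comm p (p ^ m))))
    where
    regroup : ∀ q p → q ℕ.* q ℕ.* p ℕ.* p ≡ q ℕ.* p ℕ.* (q ℕ.* p)
    regroup = ℕ-Solver.solve-∀

  isSquare⇒even : ∀ m → IsSquare (p ^ m) → 2 ∣ m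
  isSquare⇒even zero          _ = divides 0 refl
  isSquare⇒even (suc zero)    (k , k²≡p) with q , q²p≡1 ← square≡p^1+m⇒cofactor {k} {0} k²≡p =
    ⊥-elim (nonTrivial⇒≢1 (∣1⇒≡1 (divides (q ℕ.* q) (sym q²p≡1))))
  isSquare⇒even (suc (suc m)) (k , k²≡p^2+m)
    with q , q²p≡p^1+m ← square≡p^1+m⇒cofactor {k} {suc m} k²≡p^2+m =
    ∣m∣n⇒∣m+n ∣-refl (isSquare⇒even m (q , *-cancelʳ-≡ (q ℕ.* q) (p ^ m) p (trans q²p≡p^1+m (*-comm p (p ^ m)))))

  isSquare-p^⇔even : ∀ {m} → IsSquare (p ^ m) ⇔ 2 ∣ m
  isSquare-p^⇔even {m} = mk⇔ (isSquare⇒even m) (even⇒isSquare p)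

¬2∣⇒%2≡1 : ∀ m → ¬ 2 ∣ m → m % 2 ≡ 1
¬2∣⇒%2≡1 zero          2∤0   = ⊥-elim (2∤0 (divides 0 refl))
¬2∣⇒%2≡1 (suc zero)    _     = refl
¬2∣⇒%2≡1 (suc (suc m)) 2∤2+m = ¬2∣⇒%2≡1 m (2∤2+m ∘ ∣m∣n⇒∣m+n ∣-refl)

oddFactor-1 : ∀ r → oddFactor r 1 ≡ 1
oddFactor-1 r with does (2 ∣? ℤ.∣ r ∣)
... | true  = refl
... | false = refl

oddFactor≡^%2 : ∀ r n → oddFactor r n ≡ n ^ (ℤ.∣ r ∣ % 2)
oddFactor≡^%2 r n with 2 ∣? ℤ.∣ r ∣
... | yes 2∣r rewrite n∣m⇒m%n≡0 ℤ.∣ r ∣ 2 2∣r = refl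
... | no  2∤r rewrite ¬2∣⇒%2≡1 ℤ.∣ r ∣ 2∤r = sym (*-identityʳ n)

oddFactors≡p^ : ∀ p β r r₁ rₚ →
  (p ^ β) ^ ℤ.∣ r ∣ ℕ.* (oddFactor r₁ 1 ℕ.* oddFactor rₚ p) ≡ p ^ (β ℕ.* ℤ.∣ r ∣ ℕ.+ ℤ.∣ rₚ ∣ % 2)
oddFactors≡p^ p β r r₁ rₚ = begin
  (p ^ β) ^ ℤ.∣ r ∣ ℕ.* (oddFactor r₁ 1 ℕ.* oddFactor rₚ p)
    ≡⟨ cong₂ ℕ._*_ (^-*-assoc p β ℤ.∣ r ∣) (cong₂ ℕ._*_ (oddFactor-1 r₁) (oddFactor≡^%2 rₚ p)) ⟩
  p ^ (β ℕ.* ℤ.∣ r ∣) ℕ.* (1 ℕ.* p ^ (ℤ.∣ rₚ ∣ % 2))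
    ≡⟨ cong (p ^ (β ℕ.* ℤ.∣ r ∣) ℕ.*_) (*-identityˡ (p ^ (ℤ.∣ rₚ ∣ % 2))) ⟩
  p ^ (β ℕ.* ℤ.∣ r ∣) ℕ.* p ^ (ℤ.∣ rₚ ∣ % 2)
    ≡⟨ ^-distribˡ-+-* p (β ℕ.* ℤ.∣ r ∣) (ℤ.∣ rₚ ∣ % 2) ⟨
  p ^ (β ℕ.* ℤ.∣ r ∣ ℕ.+ ℤ.∣ rₚ ∣ % 2) ∎
  where open ≡-Reasoning

isSquare-oddFactors⇔2∣ : ∀ {p} → Prime p → ∀ β r r₁ rₚ →
  IsSquare ((p ^ β) ^ ℤ.∣ r ∣ ℕ.* (oddFactor r₁ 1 ℕ.* oddFactor rₚ p)) ⇔ + 2 ∣ℤ + β * r + rₚ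
isSquare-oddFactors⇔2∣ {p} p-prime β r r₁ rₚ = begin
  IsSquare ((p ^ β) ^ ℤ.∣ r ∣ ℕ.* (oddFactor r₁ 1 ℕ.* oddFactor rₚ p))  ≡⟨ cong IsSquare (oddFactors≡p^ p β r r₁ rₚ) ⟩
  IsSquare (p ^ e)                                                      ≈⟨ isSquare-p^⇔even p-prime ⟩
  + 2 ∣ℤ + e                                                            ≈⟨ ≡mod⇒∣ℤ⇔∣ℤ e≡βr+rₚ ⟩
  + 2 ∣ℤ + β * r + rₚ                                                   ∎
  where
  open ⇔-Reasoning
  e : ℕ
  e = β ℕ.* ℤ.∣ r ∣ ℕ.+ ℤ.∣ rₚ ∣ % 2
  e≡βr+rₚ : + e ≡ + β * r + rₚ mod 2
  e≡βr+rₚ = ≡mod-trans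
    (≡⇒≡mod (trans (ℤ.pos-+ (β ℕ.* ℤ.∣ r ∣) (ℤ.∣ rₚ ∣ % 2)) (cong (_+ + (ℤ.∣ rₚ ∣ % 2)) (ℤ.pos-* β ℤ.∣ r ∣))))
    (+-cong-≡mod (*-cong-≡mod (≡mod-refl {x = + β}) (∣∣≡mod2 r))
                 (≡mod-trans (≡mod-sym (≡mod-%ℕ (+ ℤ.∣ rₚ ∣) 2)) (∣∣≡mod2 rₚ)))

-- Residues modulo 24

%-distribˡ-^ : ∀ m k d .{{_ : NonZero d}} → (m ^ k) % d ≡ ((m % d) ^ k) % d
%-distribˡ-^ m zero    d = refl
%-distribˡ-^ m (suc k) d = begin
  (m ℕ.* m ^ k) % d                          ≡⟨ %-distribˡ-* m (m ^ k) d ⟩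
  (m % d ℕ.* (m ^ k % d)) % d                ≡⟨ cong (λ x → (m % d ℕ.* x) % d) (%-distribˡ-^ m k d) ⟩
  (m % d ℕ.* ((m % d) ^ k % d)) % d          ≡⟨ cong (λ x → (x ℕ.* ((m % d) ^ k % d)) % d) (m%n%n≡m%n m d) ⟨
  (m % d % d ℕ.* ((m % d) ^ k % d)) % d      ≡⟨ %-distribˡ-* (m % d) ((m % d) ^ k) d ⟨
  (m % d ℕ.* (m % d) ^ k) % d                ∎
  where open ≡-Reasoning

gcd[m,n+kd]≡gcd[m,n] : ∀ {m d} n k → m ∣ d → gcd m (n ℕ.+ k ℕ.* d) ≡ gcd m n
gcd[m,n+kd]≡gcd[m,n] {m} {d} n k m∣d = ∣-antisym
  (gcd-greatest (gcd[m,n]∣m m n+kd) (∣n+kd⇒∣n (gcd[m,n]∣m m n+kd) (gcd[m,n]∣n m n+kd)))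
  (gcd-greatest (gcd[m,n]∣m m n) (∣m∣n⇒∣m+n (gcd[m,n]∣n m n) (∣kd (gcd[m,n]∣m m n))))
  where
  n+kd : ℕ
  n+kd = n ℕ.+ k ℕ.* d
  ∣kd : ∀ {c} → c ∣ m → c ∣ k ℕ.* d
  ∣kd c∣m = ∣n⇒∣m*n k (∣-trans c∣m m∣d)
  ∣n+kd⇒∣n : ∀ {c} → c ∣ m → c ∣ n+kd → c ∣ n
  ∣n+kd⇒∣n {c} c∣m c∣n+kd = ∣m+n∣m⇒∣n (subst (c ∣_) (+-comm n (k ℕ.* d)) c∣n+kd) (∣kd c∣m)

gcd[12,n]≢0 : ∀ n → NonZero (gcd 12 n)
gcd[12,n]≢0 n = ≢-nonZero (gcd[m,n]≢0 12 n (inj₁ λ ()))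

coeff∣24 : ∀ p → coeff p ∣ 24
coeff∣24 p = m/n∣m {{gcd[12,n]≢0 (p ∸ 1)}} (∣-trans (gcd[m,n]∣m 12 (p ∸ 1)) (divides 2 refl))

coeff-%24 : ∀ p → 0 < p % 24 → coeff p ≡ coeff (p % 24)
coeff-%24 p 0<p%24 = /-congʳ {m = 24} {{gcd[12,n]≢0 (p ∸ 1)}} {{gcd[12,n]≢0 (p % 24 ∸ 1)}} gcd≡
  where
  p∸1≡ : p ∸ 1 ≡ p % 24 ∸ 1 ℕ.+ p / 24 ℕ.* 24
  p∸1≡ = trans (cong (_∸ 1) (m≡m%n+[m/n]*n p 24)) (+-∸-comm (p / 24 ℕ.* 24) 0<p%24)
  gcd≡ : gcd 12 (p ∸ 1) ≡ gcd 12 (p % 24 ∸ 1)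
  gcd≡ = trans (cong (gcd 12) p∸1≡) (gcd[m,n+kd]≡gcd[m,n] {12} (p % 24 ∸ 1) (p / 24) (divides 2 refl))

primeResidues : List ℕ
primeResidues = 1 ∷ 2 ∷ 3 ∷ 5 ∷ 7 ∷ 11 ∷ 13 ∷ 17 ∷ 19 ∷ 23 ∷ []

<24⇒∈primeResidues⊎2∣⊎3∣ : ∀ {R} → R < 24 → R ∈ primeResidues ⊎ 2 ∣ R ⊎ 3 ∣ R
<24⇒∈primeResidues⊎2∣⊎3∣ = from-yes (allUpTo? (λ R → R ∈? primeResidues ⊎-dec 2 ∣? R ⊎-dec 3 ∣? R) 24)

∣n∧∣p%n⇒≡p : ∀ {p d n} .{{_ : NonZero n}} → Prime p → .{{NonTrivial d}} → d ∣ n → d ∣ p % n → d ≡ p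
∣n∧∣p%n⇒≡p p-prime d∣n d∣p%n with prime⇒irreducible p-prime (∣n∣m%n⇒∣m d∣n d∣p%n)
... | inj₁ d≡1 = contradiction d≡1 nonTrivial⇒≢1
... | inj₂ d≡p = d≡p

prime%24∈primeResidues : ∀ {p} → Prime p → p % 24 ∈ primeResidues
prime%24∈primeResidues {p} p-prime with <24⇒∈primeResidues⊎2∣⊎3∣ (m%n<n p 24)
... | inj₁ p%24∈ = p%24∈
... | inj₂ (inj₁ 2∣p%24) rewrite sym (∣n∧∣p%n⇒≡p p-prime (divides 12 refl) 2∣p%24) = there (here refl)
... | inj₂ (inj₂ 3∣p%24) rewrite sym (∣n∧∣p%n⇒≡p p-prime (divides 8 refl) 3∣p%24) = there (there (here refl))

∈primeResidues⇒>0 : ∀ {R} → R ∈ primeResidues → 0 < R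
∈primeResidues⇒>0 = lookup (from-yes (all? (0 <?_) primeResidues))

-- Since n⁵ ≡ n³ and n⁶ ≡ n⁴ (mod 24) for every n, the residue of p^β is that of p or p³ for odd β
-- and that of p² or p⁴ for even β.
powerResidues : ℕ → ℕ → List ℕ
powerResidues P zero    = P ^ 2 % 24 ∷ P ^ 4 % 24 ∷ []
powerResidues P (suc _) = P ^ 1 % 24 ∷ P ^ 3 % 24 ∷ []

powerResidues-step : ∀ {P} → P < 24 → ∀ {b} → b < 2 →
  All (λ L → (P ^ 2 % 24 ℕ.* L) % 24 ∈ powerResidues P b) (powerResidues P b)
powerResidues-step = from-yes
  (allUpTo? (λ P → allUpTo? (λ b →
    all? (λ L → (P ^ 2 % 24 ℕ.* L) % 24 ∈? powerResidues P b) (powerResidues P b)) 2) 24)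

^%24∈powerResidues : ∀ p β → 0 < β → p ^ β % 24 ∈ powerResidues (p % 24) (β % 2)
^%24∈powerResidues p 1 _ = here (%-distribˡ-^ p 1 24)
^%24∈powerResidues p 2 _ = here (%-distribˡ-^ p 2 24)
^%24∈powerResidues p (suc (suc (suc β))) _ =
  subst (_∈ powerResidues (p % 24) (suc β % 2)) (sym p^[3+β]%24≡)
    (lookup (powerResidues-step (m%n<n p 24) (m%n<n (suc β) 2)) (^%24∈powerResidues p (suc β) z<s))
  where
  open ≡-Reasoning
  p^[3+β]%24≡ : p ^ (2 ℕ.+ suc β) % 24 ≡ ((p % 24) ^ 2 % 24 ℕ.* (p ^ suc β % 24)) % 24
  p^[3+β]%24≡ = begin
    p ^ (2 ℕ.+ suc β) % 24                         ≡⟨ cong (_% 24) (^-distribˡ-+-* p 2 (suc β)) ⟩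
    (p ^ 2 ℕ.* p ^ suc β) % 24                     ≡⟨ %-distribˡ-* (p ^ 2) (p ^ suc β) 24 ⟩
    (p ^ 2 % 24 ℕ.* (p ^ suc β % 24)) % 24         ≡⟨ cong (λ x → (x ℕ.* (p ^ suc β % 24)) % 24) (%-distribˡ-^ p 2 24) ⟩
    ((p % 24) ^ 2 % 24 ℕ.* (p ^ suc β % 24)) % 24  ∎

-- Reduction to residues modulo 24

Conditions : ℕ → ℕ → ℕ → ℤ → ℤ → ℤ → Set
Conditions p l b r r₁ rₚ =
  + 24 ∣ℤ r₁ * (+ l - + 1) + rₚ * (+ (p ℕ.* l) - + 1) ×
  + 24 ∣ℤ + p * r₁ * (+ l - + 1) + rₚ * (+ (p ℕ.* l) - + 1) ×
  + 2 ∣ℤ + b * r + rₚ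

_∣ℤ?_ : ∀ d x → Dec (+ d ∣ℤ x)
d ∣ℤ? x = d ∣? ℤ.∣ x ∣

conditions? : ∀ p l b r r₁ rₚ → Dec (Conditions p l b r r₁ rₚ)
conditions? p l b r r₁ rₚ =
  24 ∣ℤ? (r₁ * (+ l - + 1) + rₚ * (+ (p ℕ.* l) - + 1)) ×-dec
  24 ∣ℤ? (+ p * r₁ * (+ l - + 1) + rₚ * (+ (p ℕ.* l) - + 1)) ×-dec
  2 ∣ℤ? (+ b * r + rₚ)

admissible⇔conditions : ∀ {p} → Prime p → ∀ β r r₁ rₚ →
  Admissible p β r r₁ rₚ ⇔ (r₁ + rₚ ≡ r × Conditions p (p ^ β) β r r₁ rₚ)
admissible⇔conditions p-prime β r r₁ rₚ =
  ⇔-id _ ×-⇔ ⇔-id _ ×-⇔ ⇔-id _ ×-⇔ isSquare-oddFactors⇔2∣ p-prime β r r₁ rₚ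

conditions-cong : ∀ {p p′ l l′ b b′ r r′ r₁ r₁′ rₚ rₚ′} →
  + p ≡ + p′ mod 24 → + l ≡ + l′ mod 24 → + b ≡ + b′ mod 2 →
  r ≡ r′ mod 24 → r₁ ≡ r₁′ mod 24 → rₚ ≡ rₚ′ mod 24 →
  Conditions p l b r r₁ rₚ ⇔ Conditions p′ l′ b′ r′ r₁′ rₚ′
conditions-cong {p} {p′} {l} {l′} {rₚ = rₚ} {rₚ′} p≡p′ l≡l′ b≡b′ r≡r′ r₁≡r₁′ rₚ≡rₚ′ =
  ≡mod⇒∣ℤ⇔∣ℤ (+-cong-≡mod (*-cong-≡mod r₁≡r₁′ l-1≡) rₚ[pl-1]≡) ×-⇔
  ≡mod⇒∣ℤ⇔∣ℤ (+-cong-≡mod (*-cong-≡mod (*-cong-≡mod p≡p′ r₁≡r₁′) l-1≡) rₚ[pl-1]≡) ×-⇔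
  ≡mod⇒∣ℤ⇔∣ℤ (+-cong-≡mod (*-cong-≡mod b≡b′ (≡mod-weaken 2∣24 r≡r′)) (≡mod-weaken 2∣24 rₚ≡rₚ′))
  where
  2∣24 : 2 ∣ 24
  2∣24 = divides 12 refl
  l-1≡ : + l - + 1 ≡ + l′ - + 1 mod 24
  l-1≡ = minus-cong-≡mod l≡l′ (≡mod-refl {x = + 1})
  pl≡p′l′ : + (p ℕ.* l) ≡ + (p′ ℕ.* l′) mod 24
  pl≡p′l′ = ≡mod-trans (≡⇒≡mod (ℤ.pos-* p l))
              (≡mod-trans (*-cong-≡mod p≡p′ l≡l′) (≡⇒≡mod (sym (ℤ.pos-* p′ l′))))
  rₚ[pl-1]≡ : rₚ * (+ (p ℕ.* l) - + 1) ≡ rₚ′ * (+ (p′ ℕ.* l′) - + 1) mod 24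
  rₚ[pl-1]≡ = *-cong-≡mod rₚ≡rₚ′ (minus-cong-≡mod pl≡p′l′ (≡mod-refl {x = + 1}))

-- Indexed by β % 2: the component of (r₁, rₚ) that a solution fixes to a multiple of coeff p.
constrained : ℕ → ℤ → ℤ → ℤ
constrained zero    r₁ rₚ = rₚ
constrained (suc _) r₁ rₚ = r₁

constrained-cong : ∀ {n} b {r₁ r₁′ rₚ rₚ′} → r₁ ≡ r₁′ mod n → rₚ ≡ rₚ′ mod n →
  constrained b r₁ rₚ ≡ constrained b r₁′ rₚ′ mod n
constrained-cong zero    _       rₚ≡rₚ′ = rₚ≡rₚ′
constrained-cong (suc _) r₁≡r₁′ _      = r₁≡r₁′

constrained-root : ∀ b r → ∃₂ λ r₁ rₚ → r₁ + rₚ ≡ r × constrained b r₁ rₚ ≡ + 0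
constrained-root zero    r = r , + 0 , ℤ.+-identityʳ r , refl
constrained-root (suc _) r = + 0 , r , ℤ.+-identityˡ r , refl

ResidueCharacterisation : ℕ → ℕ → ℕ → ℕ → ℕ → Set
ResidueCharacterisation P b L s a =
  Conditions P L b (+ s) (+ a) (+ s - + a) ⇔
  (+ 24 ∣ℤ + s * (+ P * + P - + 1) × + coeff P ∣ℤ constrained b (+ a) (+ s - + a))

residueCharacterisation : ∀ {P} → P ∈ primeResidues → ∀ {b} → b < 2 → ∀ {L} → L ∈ powerResidues P b →
                          ∀ {s} → s < 24 → ∀ {a} → a < 24 → ResidueCharacterisation P b L s a
residueCharacterisation P∈ b<2 L∈ = lookup (lookup table P∈ b<2) L∈
  where
  _⇔?_ : ∀ {A B : Set} → Dec A → Dec B → Dec (A ⇔ B)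
  A? ⇔? B? = map′ (λ (f , g) → mk⇔ f g) (λ A⇔B → Equivalence.to A⇔B , Equivalence.from A⇔B)
                  ((A? →-dec B?) ×-dec (B? →-dec A?))
  residueCharacterisation? : ∀ P b L s a → Dec (ResidueCharacterisation P b L s a)
  residueCharacterisation? P b L s a =
    conditions? P L b (+ s) (+ a) (+ s - + a) ⇔?
    (24 ∣ℤ? (+ s * (+ P * + P - + 1)) ×-dec coeff P ∣ℤ? constrained b (+ a) (+ s - + a))
  table : All (λ P → ∀ {b} → b < 2 →
                 All (λ L → ∀ {s} → s < 24 → ∀ {a} → a < 24 → ResidueCharacterisation P b L s a) (powerResidues P b))
              primeResidues
  table = from-yes (all? (λ P → allUpTo? (λ b → all? (λ L → allUpTo? (λ s → allUpTo? (λ a →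
            residueCharacterisation? P b L s a) 24) 24) (powerResidues P b)) 2) primeResidues)

pos[n*n∸1] : ∀ n .{{_ : NonZero n}} → + (n ℕ.* n ∸ 1) ≡ + n * + n - + 1
pos[n*n∸1] (suc n) = refl

+≡⇔≡- : ∀ {r r₁ rₚ} → r₁ + rₚ ≡ r ⇔ rₚ ≡ r - r₁
+≡⇔≡- {r} {r₁} {rₚ} = mk⇔
  (λ r₁+rₚ≡r → trans (sym (cancelˡ r₁ rₚ)) (cong (_- r₁) r₁+rₚ≡r))
  (λ rₚ≡r-r₁ → trans (cong (λ z → r₁ + z) rₚ≡r-r₁) (cancelʳ r r₁))
  where
  cancelˡ : ∀ r₁ rₚ → (r₁ + rₚ) - r₁ ≡ rₚ
  cancelˡ = solve-∀
  cancelʳ : ∀ r r₁ → r₁ + (r - r₁) ≡ r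
  cancelʳ = solve-∀

-≡⇔≡- : ∀ {x y z} → x - y ≡ z ⇔ y ≡ x - z
-≡⇔≡- {x} {y} {z} = mk⇔
  (λ x-y≡z → trans (sym (cancel x y)) (cong (λ w → x - w) x-y≡z))
  (λ y≡x-z → trans (cong (λ w → x - w) y≡x-z) (cancel x z))
  where
  cancel : ∀ x y → x - (x - y) ≡ y
  cancel = solve-∀

∣ℤ⇔∃ : ∀ {c x} → + c ∣ℤ x ⇔ ∃ λ y → x ≡ + c * y
∣ℤ⇔∃ {c} {x} = mk⇔
  (λ c∣x → let Signed.divides q x≡qc = Signed.∣ᵤ⇒∣ {+ c} {x} c∣x
           in q , trans x≡qc (ℤ.*-comm q (+ c)))
  (λ (y , x≡cy) → Signed.∣⇒∣ᵤ (Signed.divides y (trans x≡cy (ℤ.*-comm (+ c) y))))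

∣ℤ⇔∃-neg : ∀ {c x} → + c ∣ℤ x ⇔ ∃ λ y → x ≡ - (+ c * y)
∣ℤ⇔∃-neg {c} {x} = mk⇔
  (λ c∣x → let y , x≡cy = Equivalence.to ∣ℤ⇔∃ c∣x in - y , trans x≡cy (negate-twice (+ c) y))
  (λ (y , x≡-cy) → Equivalence.from ∣ℤ⇔∃ (- y , trans x≡-cy (ℤ.neg-distribʳ-* (+ c) y)))
  where
  negate-twice : ∀ c y → c * y ≡ - (c * - y)
  negate-twice = solve-∀

module _ {p} (p-prime : Prime p) {β} (0<β : 0 < β) {r : ℤ} where

  private instance
    p≢0 = prime⇒nonZero p-prime

  Solution : ℕ → ℤ → ℤ → Set
  Solution b r₁ rₚ = r₁ + rₚ ≡ r × + coeff p ∣ℤ constrained b r₁ rₚ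

  admissible⇔ : ∀ r₁ rₚ →
    Admissible p β r r₁ rₚ ⇔ (r₁ + rₚ ≡ r × (+ 24 ∣ℤ r * + (p ℕ.* p ∸ 1) × + coeff p ∣ℤ constrained (β % 2) r₁ rₚ))
  admissible⇔ r₁ rₚ = begin
    Admissible p β r r₁ rₚ                          ≈⟨ admissible⇔conditions p-prime β r r₁ rₚ ⟩
    (r₁ + rₚ ≡ r × Conditions p (p ^ β) β r r₁ rₚ)  ≈⟨ Σ-⇔ (↠-id _) (λ {r₁+rₚ≡r} → residues r₁+rₚ≡r) ⟩
    (r₁ + rₚ ≡ r × (+ 24 ∣ℤ r * + (p ℕ.* p ∸ 1) × + coeff p ∣ℤ constrained b r₁ rₚ)) ∎
    where
    open ⇔-Reasoning
    P L b s a : ℕ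
    P = p % 24
    L = p ^ β % 24
    b = β % 2
    s = r %ℕ 24
    a = r₁ %ℕ 24
    residues : r₁ + rₚ ≡ r →
      Conditions p (p ^ β) β r r₁ rₚ ⇔ (+ 24 ∣ℤ r * + (p ℕ.* p ∸ 1) × + coeff p ∣ℤ constrained b r₁ rₚ)
    residues r₁+rₚ≡r = begin
      Conditions p (p ^ β) β r r₁ rₚ
        ≈⟨ conditions-cong p≡P (≡mod-%ℕ (+ (p ^ β)) 24) (≡mod-%ℕ (+ β) 2) r≡s r₁≡a rₚ≡s-a ⟩
      Conditions P L b (+ s) (+ a) (+ s - + a)
        ≈⟨ residueCharacterisation (prime%24∈primeResidues p-prime) (m%n<n β 2) (^%24∈powerResidues p β 0<β)
                                   (n%ℕd<d r 24) (n%ℕd<d r₁ 24) ⟩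
      Reduced (coeff P)
        ≡⟨ cong Reduced (sym coeff≡) ⟩
      Reduced (coeff p)
        ≈⟨ ≡mod⇒∣ℤ⇔∣ℤ discriminant≡ ×-⇔ ≡mod⇒∣ℤ⇔∣ℤ constrained≡ ⟨
      (+ 24 ∣ℤ r * + (p ℕ.* p ∸ 1) × + coeff p ∣ℤ constrained b r₁ rₚ) ∎
      where
      Reduced : ℕ → Set
      Reduced c = + 24 ∣ℤ + s * (+ P * + P - + 1) × + c ∣ℤ constrained b (+ a) (+ s - + a)
      p≡P : + p ≡ + P mod 24
      p≡P = ≡mod-%ℕ (+ p) 24
      r≡s : r ≡ + s mod 24
      r≡s = ≡mod-%ℕ r 24
      r₁≡a : r₁ ≡ + a mod 24
      r₁≡a = ≡mod-%ℕ r₁ 24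
      rₚ≡s-a : rₚ ≡ + s - + a mod 24
      rₚ≡s-a = ≡mod-trans (≡⇒≡mod (Equivalence.to +≡⇔≡- r₁+rₚ≡r)) (minus-cong-≡mod r≡s r₁≡a)
      discriminant≡ : r * + (p ℕ.* p ∸ 1) ≡ + s * (+ P * + P - + 1) mod 24
      discriminant≡ = *-cong-≡mod r≡s
        (≡mod-trans (≡⇒≡mod (pos[n*n∸1] p)) (minus-cong-≡mod (*-cong-≡mod p≡P p≡P) (≡mod-refl {x = + 1})))
      constrained≡ : constrained b r₁ rₚ ≡ constrained b (+ a) (+ s - + a) mod coeff p
      constrained≡ = ≡mod-weaken (coeff∣24 p) (constrained-cong b r₁≡a rₚ≡s-a)
      coeff≡ : coeff p ≡ coeff P
      coeff≡ = coeff-%24 p (∈primeResidues⇒>0 (prime%24∈primeResidues p-prime))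

  solvable⇔ : (∃₂ λ r₁ rₚ → Admissible p β r r₁ rₚ) ⇔ + 24 ∣ℤ r * + (p ℕ.* p ∸ 1)
  solvable⇔ = mk⇔
    (λ (r₁ , rₚ , admissible) → proj₁ (proj₂ (Equivalence.to (admissible⇔ r₁ rₚ) admissible)))
    (λ 24∣ → let r₁ , rₚ , r₁+rₚ≡r , root = constrained-root (β % 2) r
             in r₁ , rₚ , Equivalence.from (admissible⇔ r₁ rₚ)
                            (r₁+rₚ≡r , 24∣ , subst (+ coeff p ∣ℤ_) (sym root) (coeff p ∣0)))

  module _ (24∣ : + 24 ∣ℤ r * + (p ℕ.* p ∸ 1)) (r₁ rₚ : ℤ) where

    admissible⇔solution : Admissible p β r r₁ rₚ ⇔ Solution (β % 2) r₁ rₚ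
    admissible⇔solution = (⇔-id _ ×-⇔ mk⇔ proj₂ (24∣ ,_)) ⇔-∘ admissible⇔ r₁ rₚ

    admissible⇔odd-solution : ¬ 2 ∣ β →
      Admissible p β r r₁ rₚ ⇔ (∃ λ y → (r₁ ≡ - (+ coeff p * y)) × (rₚ ≡ r - r₁))
    admissible⇔odd-solution 2∤β = begin
      Admissible p β r r₁ rₚ                          ≈⟨ admissible⇔solution ⟩
      Solution (β % 2) r₁ rₚ                          ≡⟨ cong (λ b → Solution b r₁ rₚ) (¬2∣⇒%2≡1 β 2∤β) ⟩
      (r₁ + rₚ ≡ r × + coeff p ∣ℤ r₁)                 ≈⟨ +≡⇔≡- ×-⇔ ∣ℤ⇔∃-neg ⟩
      (rₚ ≡ r - r₁ × ∃ λ y → r₁ ≡ - (+ coeff p * y))  ≈⟨ mk⇔ (λ (diff , y , r₁≡-cy) → y , r₁≡-cy , diff)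
                                                             (λ (y , r₁≡-cy , diff) → diff , y , r₁≡-cy) ⟩
      (∃ λ y → (r₁ ≡ - (+ coeff p * y)) × (rₚ ≡ r - r₁)) ∎
      where open ⇔-Reasoning

    admissible⇔even-solution : 2 ∣ β →
      Admissible p β r r₁ rₚ ⇔ (∃ λ y → (r₁ ≡ r - + coeff p * y) × (rₚ ≡ r - r₁))
    admissible⇔even-solution 2∣β = begin
      Admissible p β r r₁ rₚ                          ≈⟨ admissible⇔solution ⟩
      Solution (β % 2) r₁ rₚ                          ≡⟨ cong (λ b → Solution b r₁ rₚ) (n∣m⇒m%n≡0 β 2 2∣β) ⟩
      (r₁ + rₚ ≡ r × + coeff p ∣ℤ rₚ)                 ≈⟨ +≡⇔≡- ×-⇔ ∣ℤ⇔∃ ⟩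
      (rₚ ≡ r - r₁ × ∃ λ y → rₚ ≡ + coeff p * y)      ≈⟨ mk⇔ (λ (diff , y , rₚ≡cy) → y , solve-r₁ diff rₚ≡cy , diff)
                                                             (λ (y , r₁≡r-cy , diff) → diff , y , solve-rₚ diff r₁≡r-cy) ⟩
      (∃ λ y → (r₁ ≡ r - + coeff p * y) × (rₚ ≡ r - r₁)) ∎
      where
      open ⇔-Reasoning
      solve-r₁ : ∀ {z} → rₚ ≡ r - r₁ → rₚ ≡ z → r₁ ≡ r - z
      solve-r₁ diff rₚ≡z = Equivalence.to (-≡⇔≡- {x = r}) (trans (sym diff) rₚ≡z)
      solve-rₚ : ∀ {z} → rₚ ≡ r - r₁ → r₁ ≡ r - z → rₚ ≡ z
      solve-rₚ diff r₁≡r-z = trans diff (Equivalence.from (-≡⇔≡- {x = r}) r₁≡r-z)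

lemma6p2 : (p β : ℕ) → Prime p → 0 < β → (r : ℤ) →
    ((∃₂ λ r₁ rₚ → Admissible p β r r₁ rₚ) ⇔ ((ℤ.+ 24) ∣ℤ (r ℤ.* ℤ.+ (p ℕ.* p ℕ.∸ 1))))
    × ((ℤ.+ 24) ∣ℤ (r ℤ.* ℤ.+ (p ℕ.* p ℕ.∸ 1)) → ∀ r₁ rₚ →
        (¬ (2 ∣ β) → (Admissible p β r r₁ rₚ ⇔ (∃ λ y → (r₁ ≡ ℤ.- (ℤ.+ coeff p ℤ.* y)) × (rₚ ≡ r ℤ.- r₁))))
        × (2 ∣ β → (Admissible p β r r₁ rₚ ⇔ (∃ λ y → (r₁ ≡ r ℤ.- ℤ.+ coeff p ℤ.* y) × (rₚ ≡ r ℤ.- r₁)))))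
lemma6p2 p β p-prime 0<β r =
  solvable⇔ p-prime 0<β ,
  λ 24∣ r₁ rₚ → admissible⇔odd-solution p-prime 0<β 24∣ r₁ rₚ ,
                admissible⇔even-solution p-prime 0<β 24∣ r₁ rₚ
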